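{- Let $m\geq 2$ and $1\leq i\leq m-1$. Then $$\frac{d_{i-1}(m)}{\binom{m}{i-1}}\cdot\frac{d_{i+1}(m)}{\binom{m}{i+1}}>\left(\frac{d_i(m)}{\binom{m}{i}}\right)^2,$$ or equivalently, $$\frac{d_i(m)^2}{d_{i-1}(m)d_{i+1}(m)}<\frac{(m-i+1)(i+1)}{(m-i)i}.$$
   Context: For integers $m\geq 0$, the Boros-Moll polynomial is $P_m(a)=2^{ -2m}\sum_{k}2^k\binom{2m-2k}{m-k}\binom{m+k}{k}(a+1)^k=\sum_{i=0}^m d_i(m)a^i$, so that $d_i(m)=2^{ -2m}\sum_{k=0}^m 2^k\binom{2m-2k}{m-k}\binom{m+k}{m}\binom{k}{i}$ for $0\le i\le m$. These coefficients are positive. -}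

module Defs where

import Data.Nat
import Data.Nat.Properties

open import Data.Nat using (ℕ; zero; suc; _+_; _*_; _∸_; _^_)
open import Data.Nat.Combinatorics using (_C_)
open import Data.List using (List; map; upTo)
open import Data.Nat.ListAction using (sum)
open import Data.Integer using (+_)
open import Data.Rational using (ℚ; _/_; 0ℚ)
import Data.Rational as ℚ

scaledD : ℕ → ℕ → ℕ
scaledD i m = sum (map (λ k → 2 ^ k * ((2 * m ∸ 2 * k) C (m ∸ k)) * ((m + k) C m) * (k C i))
                       (upTo (suc m)))

-- Boros–Moll coefficient d_i(m) = 2^{-2m} Σ_k 2^k C(2m-2k,m-k) C(m+k,m) C(k,i), as a rational
d : ℕ → ℕ → ℚ
d i m = _/_ (+ scaledD i m) (2 ^ (2 * m)) {{ nz (2 * m) }}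
  where
  nz : (n : ℕ) → Data.Nat.NonZero (2 ^ n)
  nz n = Data.Nat.Properties.m^n≢0 2 n

-- division of a rational by a natural number; only used with n > 0
-- (the binomials C(m,j) for j ≤ m); returns 0 for n = 0 by convention.
_÷ℕ_ : ℚ → ℕ → ℚ
x ÷ℕ zero = 0ℚ
x ÷ℕ suc n = x ℚ.* ((+ 1) / suc n)

module Submission where

-- Reindexing the defining sum by j = m − k and clearing factorials gives
--   m! · 2^{2m} d_i(m) = C(m, i) · 2^m · T(m − i),   T(n) = Σ_j β_j C(n, j),
-- where β_j = (2j − 1)!! (m + 1)(m + 2) ⋯ (2m − j); so d_i(m) / C(m, i) = T(m − i) / (2^m m!)
-- and the claim becomes strict log-convexity T(k)² < T(k − 1) T(k + 1) of the binomial
-- transform T of β.  The ratio β_{j+1}/β_j = (2j + 1)/(m − j) increases with j, so β is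
-- strictly log-convex, and the binomial transform preserves this: by Pascal's rule
-- T(n + 1) and T(n + 2) are the transforms at n of the neighbour sums β_j + β_{j+1} and of
-- their neighbour sums, and a Cauchy–Schwarz inequality for sums compares them with T(n).

open import Defs

module FiniteSums where
  open import Data.Nat
  open import Data.Nat.Properties
  open import Data.List using (map; upTo; applyUpTo)
  open import Data.Nat.ListAction using (sum)
  open import Data.Nat.Tactic.RingSolver using (solve-∀)
  open import Function using (_∘_)
  open import Relation.Binary.PropositionalEquality
  open ≡-Reasoning

  Σ : (ℕ → ℕ) → ℕ → ℕ
  Σ f zero = 0
  Σ f (suc n) = Σ f n + f n

  Σ-peel-first : ∀ f n → Σ f (suc n) ≡ f 0 + Σ (f ∘ suc) n
  Σ-peel-first f zero = +-comm 0 (f 0)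
  Σ-peel-first f (suc n) = begin
    Σ f (suc n) + f (suc n)          ≡⟨ cong (_+ f (suc n)) (Σ-peel-first f n) ⟩
    f 0 + Σ (f ∘ suc) n + f (suc n)  ≡⟨ +-assoc (f 0) _ _ ⟩
    f 0 + Σ (f ∘ suc) (suc n)        ∎

  sum-map-applyUpTo : ∀ (f g : ℕ → ℕ) n → sum (map f (applyUpTo g n)) ≡ Σ (f ∘ g) n
  sum-map-applyUpTo f g zero = refl
  sum-map-applyUpTo f g (suc n) = begin
    f (g 0) + sum (map f (applyUpTo (g ∘ suc) n)) ≡⟨ cong (f (g 0) +_) (sum-map-applyUpTo f (g ∘ suc) n) ⟩
    f (g 0) + Σ (f ∘ g ∘ suc) n                   ≡⟨ Σ-peel-first (f ∘ g) n ⟨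
    Σ (f ∘ g) (suc n)                             ∎

  sum-map-upTo : ∀ (f : ℕ → ℕ) n → sum (map f (upTo n)) ≡ Σ f n
  sum-map-upTo f = sum-map-applyUpTo f (λ x → x)

  Σ-reverse : ∀ f n → Σ f (suc n) ≡ Σ (λ j → f (n ∸ j)) (suc n)
  Σ-reverse f zero = refl
  Σ-reverse f (suc n) = begin
    Σ f (suc n) + f (suc n)                     ≡⟨ cong (_+ f (suc n)) (Σ-reverse f n) ⟩
    Σ (λ j → f (n ∸ j)) (suc n) + f (suc n)     ≡⟨ +-comm _ (f (suc n)) ⟩
    f (suc n) + Σ (λ j → f (n ∸ j)) (suc n)     ≡⟨ Σ-peel-first (λ j → f (suc n ∸ j)) (suc n) ⟨
    Σ (λ j → f (suc n ∸ j)) (suc (suc n))       ∎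

  Σ-cong : ∀ {f g} n → (∀ j → j < n → f j ≡ g j) → Σ f n ≡ Σ g n
  Σ-cong zero h = refl
  Σ-cong (suc n) h = cong₂ _+_ (Σ-cong n (λ j j<n → h j (m<n⇒m<1+n j<n))) (h n ≤-refl)

  Σ-distrib-+ : ∀ f g n → Σ (λ j → f j + g j) n ≡ Σ f n + Σ g n
  Σ-distrib-+ f g zero = refl
  Σ-distrib-+ f g (suc n) = begin
    Σ (λ j → f j + g j) n + (f n + g n) ≡⟨ cong (_+ (f n + g n)) (Σ-distrib-+ f g n) ⟩
    Σ f n + Σ g n + (f n + g n)         ≡⟨ interchange (Σ f n) (Σ g n) (f n) (g n) ⟩
    Σ f (suc n) + Σ g (suc n)           ∎
    where
    interchange : ∀ a b c d → a + b + (c + d) ≡ a + c + (b + d)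
    interchange = solve-∀

  Σ-factorˡ : ∀ c f n → Σ (λ j → c * f j) n ≡ c * Σ f n
  Σ-factorˡ c f zero = sym (*-zeroʳ c)
  Σ-factorˡ c f (suc n) = begin
    Σ (λ j → c * f j) n + c * f n ≡⟨ cong (_+ c * f n) (Σ-factorˡ c f n) ⟩
    c * Σ f n + c * f n           ≡⟨ *-distribˡ-+ c (Σ f n) (f n) ⟨
    c * Σ f (suc n)               ∎

  Σ-vanishing-tail : ∀ f n k → (∀ t → f (n + t) ≡ 0) → Σ f (n + k) ≡ Σ f n
  Σ-vanishing-tail f n zero h = cong (Σ f) (+-identityʳ n)
  Σ-vanishing-tail f n (suc k) h = begin
    Σ f (n + suc k)         ≡⟨ cong (Σ f) (+-suc n k) ⟩
    Σ f (n + k) + f (n + k) ≡⟨ cong₂ _+_ (Σ-vanishing-tail f n k h) (h k) ⟩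
    Σ f n + 0               ≡⟨ +-identityʳ _ ⟩
    Σ f n                   ∎

module CauchySchwarz where
  open import Data.Nat
  open import Data.Nat.Properties
  open import Data.Nat.Tactic.RingSolver using (solve-∀)
  open import Data.Product using (_,_)
  open import Data.Sum using (inj₁; inj₂)
  open import Relation.Binary.PropositionalEquality
  open FiniteSums

  four-products≤square-ordered : ∀ {x y} → x ≤ y → 4 * (x * y) ≤ (x + y) * (x + y)
  four-products≤square-ordered {x} x≤y with m≤n⇒∃[o]m+o≡n x≤y
  ... | δ , refl = subst (4 * (x * (x + δ)) ≤_) (sym (expand x δ)) (m≤m+n _ (δ * δ))
    where
    expand : ∀ x δ → (x + (x + δ)) * (x + (x + δ)) ≡ 4 * (x * (x + δ)) + δ * δ
    expand = solve-∀

  -- 4xy ≤ (x + y)², i.e. (x − y)² ≥ 0.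
  four-products≤square : ∀ x y → 4 * (x * y) ≤ (x + y) * (x + y)
  four-products≤square x y with ≤-total x y
  ... | inj₁ x≤y = four-products≤square-ordered x≤y
  ... | inj₂ y≤x = subst₂ _≤_ (cong (4 *_) (*-comm y x)) (cong₂ _*_ (+-comm y x) (+-comm y x))
                     (four-products≤square-ordered y≤x)

  am-gm : ∀ x y z → z * z ≤ x * y → 2 * z ≤ x + y
  am-gm x y z z²≤xy = ≮⇒≥ λ x+y<2z → <-irrefl refl (begin-strict
    (x + y) * (x + y) <⟨ *-mono-< x+y<2z x+y<2z ⟩
    2 * z * (2 * z)   ≡⟨ quadruple z ⟩
    4 * (z * z)       ≤⟨ *-monoʳ-≤ 4 z²≤xy ⟩
    4 * (x * y)       ≤⟨ four-products≤square x y ⟩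
    (x + y) * (x + y) ∎)
    where
    open ≤-Reasoning
    quadruple : ∀ z → 2 * z * (2 * z) ≡ 4 * (z * z)
    quadruple = solve-∀

  -- Adding one term to each of three sums preserves C² < B·E, provided c² ≤ b·e:
  -- the cross term 2Cc is bounded by Be + bE via AM–GM, as (Cc)² ≤ (BE)(be) = (Be)(bE).
  cauchy-schwarz-step : ∀ {B E C b e c} → C * C < B * E → c * c ≤ b * e →
                        (C + c) * (C + c) < (B + b) * (E + e)
  cauchy-schwarz-step {B} {E} {C} {b} {e} {c} C²<BE c²≤be = begin-strict
    (C + c) * (C + c)               ≡⟨ square C c ⟩
    C * C + 2 * (C * c) + c * c     <⟨ +-mono-<-≤ (+-mono-<-≤ C²<BE cross-term) c²≤be ⟩
    B * E + (B * e + b * E) + b * e ≡⟨ product B b E e ⟨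
    (B + b) * (E + e)               ∎
    where
    open ≤-Reasoning
    square : ∀ C c → (C + c) * (C + c) ≡ C * C + 2 * (C * c) + c * c
    square = solve-∀
    product : ∀ B b E e → (B + b) * (E + e) ≡ B * E + (B * e + b * E) + b * e
    product = solve-∀
    regroup : ∀ x y z w → x * y * (z * w) ≡ x * z * (y * w)
    regroup = solve-∀
    swap-pairs : ∀ B E b e → B * E * (b * e) ≡ B * e * (b * E)
    swap-pairs = solve-∀
    cross-term : 2 * (C * c) ≤ B * e + b * E
    cross-term = am-gm (B * e) (b * E) (C * c) (begin
      C * c * (C * c)  ≡⟨ regroup C c C c ⟩
      C * C * (c * c)  ≤⟨ *-mono-≤ (<⇒≤ C²<BE) c²≤be ⟩
      B * E * (b * e)  ≡⟨ swap-pairs B E b e ⟩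
      B * e * (b * E)  ∎)

  Σ-cauchy-schwarz : ∀ (b e c : ℕ → ℕ) n → c 0 * c 0 < b 0 * e 0 →
                     (∀ j → j ≤ n → c j * c j ≤ b j * e j) →
                     Σ c (suc n) * Σ c (suc n) < Σ b (suc n) * Σ e (suc n)
  Σ-cauchy-schwarz b e c zero c₀²<b₀e₀ _ = c₀²<b₀e₀
  Σ-cauchy-schwarz b e c (suc n) c₀²<b₀e₀ c²≤be =
    cauchy-schwarz-step {Σ b (suc n)} {Σ e (suc n)} {Σ c (suc n)}
      (Σ-cauchy-schwarz b e c n c₀²<b₀e₀ (λ j j≤n → c²≤be j (m≤n⇒m≤1+n j≤n)))
      (c²≤be (suc n) ≤-refl)

module BinomialTransform where
  open import Data.Nat
  open import Data.Nat.Properties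
  open import Data.Nat.Combinatorics using (_C_; nCk+nC[k+1]≡[n+1]C[k+1]; k>n⇒nCk≡0)
  open import Data.Nat.Tactic.RingSolver using (solve-∀)
  open import Function using (_∘_)
  open import Relation.Binary.PropositionalEquality
  open FiniteSums
  open CauchySchwarz

  binomialTransform : (ℕ → ℕ) → ℕ → ℕ
  binomialTransform b n = Σ (λ j → b j * (n C j)) (suc n)

  -- Summing further than n changes nothing, since C(n, j) = 0 for j > n.
  binomialTransform-extend : ∀ b {n M} → n ≤ M →
    Σ (λ j → b j * (n C j)) (suc M) ≡ binomialTransform b n
  binomialTransform-extend b {n} {M} n≤M = begin
    Σ f (suc M)             ≡⟨ cong (Σ f ∘ suc) (m+[n∸m]≡n n≤M) ⟨
    Σ f (suc n + (M ∸ n))   ≡⟨ Σ-vanishing-tail f (suc n) (M ∸ n) beyond-n ⟩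
    Σ f (suc n)             ∎
    where
    open ≡-Reasoning
    f : ℕ → ℕ
    f j = b j * (n C j)
    beyond-n : ∀ t → f (suc n + t) ≡ 0
    beyond-n t = trans (cong (b (suc n + t) *_) (k>n⇒nCk≡0 (s≤s (m≤m+n n t)))) (*-zeroʳ (b (suc n + t)))

  neighbourSum : (ℕ → ℕ) → ℕ → ℕ
  neighbourSum b j = b j + b (suc j)

  -- Pascal's rule turns one step of the binomial transform into a transform of neighbour sums.
  binomialTransform-suc : ∀ b n → binomialTransform b (suc n) ≡ binomialTransform (neighbourSum b) n
  binomialTransform-suc b n = begin
    binomialTransform b (suc n)
      ≡⟨ Σ-peel-first _ (suc n) ⟩
    b 0 * 1 + Σ (λ j → b (suc j) * (suc n C suc j)) (suc n)
      ≡⟨ cong (b 0 * 1 +_) (Σ-cong (suc n) (λ j _ → pascal j)) ⟩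
    b 0 * 1 + Σ (λ j → b (suc j) * (n C j) + b (suc j) * (n C suc j)) (suc n)
      ≡⟨ cong (b 0 * 1 +_) (Σ-distrib-+ _ _ (suc n)) ⟩
    b 0 * 1 + (X + (Y + b (suc n) * (n C suc n)))
      ≡⟨ cong (λ z → b 0 * 1 + (X + (Y + b (suc n) * z))) (k>n⇒nCk≡0 (n<1+n n)) ⟩
    b 0 * 1 + (X + (Y + b (suc n) * 0))
      ≡⟨ regroup (b 0 * 1) X Y (b (suc n)) ⟩
    (b 0 * 1 + Y) + X
      ≡⟨ cong (_+ X) (Σ-peel-first _ n) ⟨
    binomialTransform b n + X
      ≡⟨ Σ-distrib-+ _ _ (suc n) ⟨
    Σ (λ j → b j * (n C j) + b (suc j) * (n C j)) (suc n)
      ≡⟨ Σ-cong (suc n) (λ j _ → *-distribʳ-+ (n C j) (b j) (b (suc j))) ⟨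
    binomialTransform (neighbourSum b) n ∎
    where
    open ≡-Reasoning
    X Y : ℕ
    X = Σ (λ j → b (suc j) * (n C j)) (suc n)
    Y = Σ (λ j → b (suc j) * (n C suc j)) n
    pascal : ∀ j → b (suc j) * (suc n C suc j) ≡ b (suc j) * (n C j) + b (suc j) * (n C suc j)
    pascal j = trans (cong (b (suc j) *_) (sym (nCk+nC[k+1]≡[n+1]C[k+1] n j)))
                     (*-distribˡ-+ (b (suc j)) (n C j) (n C suc j))
    regroup : ∀ a x y c → a + (x + (y + c * 0)) ≡ a + y + x
    regroup = solve-∀

  StrictlyLogConvexUpTo : (ℕ → ℕ) → ℕ → Set
  StrictlyLogConvexUpTo b N = ∀ j → j ≤ N → b (suc j) * b (suc j) < b j * b (suc (suc j))

  -- (b₀ + b₁)² < b₀ · ((b₀ + b₁) + (b₁ + b₂)) is exactly b₁² < b₀ b₂.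
  neighbourSum-square : ∀ b j → b (suc j) * b (suc j) < b j * b (suc (suc j)) →
    neighbourSum b j * neighbourSum b j < b j * neighbourSum (neighbourSum b) j
  neighbourSum-square b j b₁²<b₀b₂ = begin-strict
    (x + y) * (x + y)             ≡⟨ square x y ⟩
    x * x + 2 * (x * y) + y * y   <⟨ +-monoʳ-< (x * x + 2 * (x * y)) b₁²<b₀b₂ ⟩
    x * x + 2 * (x * y) + x * z   ≡⟨ outer x y z ⟩
    x * ((x + y) + (y + z))       ∎
    where
    open ≤-Reasoning
    x y z : ℕ
    x = b j
    y = b (suc j)
    z = b (suc (suc j))
    square : ∀ x y → (x + y) * (x + y) ≡ x * x + 2 * (x * y) + y * y
    square = solve-∀
    outer : ∀ x y z → x * x + 2 * (x * y) + x * z ≡ x * ((x + y) + (y + z))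
    outer = solve-∀

  weight-square : ∀ b e c w → c * c ≤ b * e → (c * w) * (c * w) ≤ (b * w) * (e * w)
  weight-square b e c w c²≤be = begin
    (c * w) * (c * w) ≡⟨ regroup c w c w ⟩
    (c * c) * (w * w) ≤⟨ *-monoˡ-≤ (w * w) c²≤be ⟩
    (b * e) * (w * w) ≡⟨ regroup b w e w ⟨
    (b * w) * (e * w) ∎
    where
    open ≤-Reasoning
    regroup : ∀ x y z t → x * y * (z * t) ≡ x * z * (y * t)
    regroup = solve-∀

  -- The binomial transform preserves strict log-convexity: writing the transform at N + 1 and
  -- N + 2 as transforms of neighbour sums at N, this is the Cauchy–Schwarz inequality above.
  binomialTransform-log-convex : ∀ b N → StrictlyLogConvexUpTo b N →
    binomialTransform b (suc N) * binomialTransform b (suc N)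
      < binomialTransform b N * binomialTransform b (suc (suc N))
  binomialTransform-log-convex b N log-convex = begin-strict
    T b (suc N) * T b (suc N) ≡⟨ cong₂ _*_ (binomialTransform-suc b N) (binomialTransform-suc b N) ⟩
    T c N * T c N             <⟨ Σ-cauchy-schwarz (weighted b) (weighted e) (weighted c) N at-zero pointwise ⟩
    T b N * T e N             ≡⟨ cong (T b N *_) (trans (binomialTransform-suc b (suc N))
                                                        (binomialTransform-suc c N)) ⟨
    T b N * T b (suc (suc N)) ∎
    where
    open ≤-Reasoning
    T : (ℕ → ℕ) → ℕ → ℕ
    T = binomialTransform
    c e : ℕ → ℕ
    c = neighbourSum b
    e = neighbourSum c
    weighted : (ℕ → ℕ) → ℕ → ℕ
    weighted f j = f j * (N C j)
    neighbour : ∀ j → j ≤ N → c j * c j < b j * e j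
    neighbour j j≤N = neighbourSum-square b j (log-convex j j≤N)
    pointwise : ∀ j → j ≤ N → weighted c j * weighted c j ≤ weighted b j * weighted e j
    pointwise j j≤N = weight-square (b j) (e j) (c j) (N C j) (<⇒≤ (neighbour j j≤N))
    at-zero : weighted c 0 * weighted c 0 < weighted b 0 * weighted e 0
    at-zero = subst₂ _<_ (cong₂ _*_ (sym (*-identityʳ (c 0))) (sym (*-identityʳ (c 0))))
                         (cong₂ _*_ (sym (*-identityʳ (b 0))) (sym (*-identityʳ (e 0))))
                         (neighbour 0 z≤n)

module FactorialIdentities where
  open import Data.Nat
  open import Data.Nat.Properties
  open import Data.Nat.Combinatorics using (_C_; nCk≡n!/k![n-k]!; k![n∸k]!∣n!; k>n⇒nCk≡0)
  open import Data.Nat.DivMod using (m/n*n≡m)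
  open import Data.Nat.Tactic.RingSolver using (solve-∀)
  open import Data.Product using (_,_)
  open import Relation.Binary.PropositionalEquality
  open import Relation.Nullary using (yes; no)
  open ≡-Reasoning

  binomial-factorials : ∀ {n k} → k ≤ n → (n C k) * (k ! * (n ∸ k) !) ≡ n !
  binomial-factorials {n} {k} k≤n =
    trans (cong (_* (k ! * (n ∸ k) !)) (nCk≡n!/k![n-k]! k≤n)) (m/n*n≡m (k![n∸k]!∣n! k≤n))
    where instance _ = k !* (n ∸ k) !≢0

  binomial-factorials-+ : ∀ a b → ((a + b) C a) * (a ! * b !) ≡ (a + b) !
  binomial-factorials-+ a b =
    subst (λ z → ((a + b) C a) * (a ! * z !) ≡ (a + b) !) (m+n∸m≡n a b) (binomial-factorials (m≤m+n a b))

  -- C(n, k) > 0 for k ≤ n, as it divides n! > 0 exactly.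
  binomial-positive : ∀ {n k} → k ≤ n → 0 < n C k
  binomial-positive {n} {k} k≤n = n≢0⇒n>0 λ C≡0 → ≢-nonZero⁻¹ (n !) {{n !≢0}}
    (trans (sym (binomial-factorials k≤n)) (cong (_* (k ! * (n ∸ k) !)) C≡0))

  oddFactorial : ℕ → ℕ
  oddFactorial zero = 1
  oddFactorial (suc j) = oddFactorial j * suc (2 * j)

  oddFactorial-nonZero : ∀ j → NonZero (oddFactorial j)
  oddFactorial-nonZero zero = _
  oddFactorial-nonZero (suc j) = m*n≢0 (oddFactorial j) (suc (2 * j)) {{oddFactorial-nonZero j}}

  -- (2j)! = 2^j · j! · (2j − 1)!!, splitting the even factors from the odd ones.
  factorial-double : ∀ j → (2 * j) ! ≡ 2 ^ j * j ! * oddFactorial j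
  factorial-double zero = refl
  factorial-double (suc j) = begin
    (2 * suc j) !                                           ≡⟨ cong _! (double-suc j) ⟩
    suc (suc (2 * j)) * (suc (2 * j) * (2 * j) !)           ≡⟨ cong (λ z → suc (suc (2 * j)) * (suc (2 * j) * z))
                                                                    (factorial-double j) ⟩
    suc (suc (2 * j)) * (suc (2 * j) * (2 ^ j * j ! * D))   ≡⟨ regroup j (2 ^ j) (j !) D ⟩
    2 * 2 ^ j * (suc j * j !) * (D * suc (2 * j))           ∎
    where
    D : ℕ
    D = oddFactorial j
    double-suc : ∀ j → 2 * suc j ≡ suc (suc (2 * j))
    double-suc = solve-∀
    regroup : ∀ j p f d → suc (suc (2 * j)) * (suc (2 * j) * (p * f * d))
                        ≡ 2 * p * (suc j * f) * (d * suc (2 * j))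
    regroup = solve-∀

  central-binomial : ∀ j → ((2 * j) C j) * j ! ≡ 2 ^ j * oddFactorial j
  central-binomial j = *-cancelʳ-≡ _ _ (j !) {{j !≢0}} (begin
    ((2 * j) C j) * j ! * j !  ≡⟨ *-assoc ((2 * j) C j) (j !) (j !) ⟩
    ((2 * j) C j) * (j ! * j !) ≡⟨ cong (λ z → (z C j) * (j ! * j !)) (double j) ⟩
    ((j + j) C j) * (j ! * j !) ≡⟨ binomial-factorials-+ j j ⟩
    (j + j) !                   ≡⟨ cong _! (double j) ⟨
    (2 * j) !                   ≡⟨ factorial-double j ⟩
    2 ^ j * j ! * D             ≡⟨ *-assoc (2 ^ j) (j !) D ⟩
    2 ^ j * (j ! * D)           ≡⟨ cong (2 ^ j *_) (*-comm (j !) D) ⟩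
    2 ^ j * (D * j !)           ≡⟨ *-assoc (2 ^ j) D (j !) ⟨
    2 ^ j * D * j !             ∎)
    where
    D : ℕ
    D = oddFactorial j
    double : ∀ j → 2 * j ≡ j + j
    double = solve-∀

  rising : ℕ → ℕ → ℕ
  rising m zero = 1
  rising m (suc k) = rising m k * suc (m + k)

  rising-nonZero : ∀ m k → NonZero (rising m k)
  rising-nonZero m zero = _
  rising-nonZero m (suc k) = m*n≢0 (rising m k) (suc (m + k)) {{rising-nonZero m k}}

  rising-factorial : ∀ m k → rising m k * m ! ≡ (m + k) !
  rising-factorial m zero = trans (*-identityˡ (m !)) (cong _! (sym (+-identityʳ m)))
  rising-factorial m (suc k) = begin
    rising m k * suc (m + k) * m ! ≡⟨ *-assoc (rising m k) (suc (m + k)) (m !) ⟩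
    rising m k * (suc (m + k) * m !) ≡⟨ cong (rising m k *_) (*-comm (suc (m + k)) (m !)) ⟩
    rising m k * (m ! * suc (m + k)) ≡⟨ *-assoc (rising m k) (m !) (suc (m + k)) ⟨
    rising m k * m ! * suc (m + k) ≡⟨ cong (_* suc (m + k)) (rising-factorial m k) ⟩
    (m + k) ! * suc (m + k)        ≡⟨ *-comm ((m + k) !) (suc (m + k)) ⟩
    (suc (m + k)) !                ≡⟨ cong _! (+-suc m k) ⟨
    (m + suc k) !                  ∎

  binomial-rising : ∀ m k → ((m + k) C m) * k ! ≡ rising m k
  binomial-rising m k = *-cancelʳ-≡ _ _ (m !) {{m !≢0}} (begin
    ((m + k) C m) * k ! * m !   ≡⟨ *-assoc ((m + k) C m) (k !) (m !) ⟩
    ((m + k) C m) * (k ! * m !) ≡⟨ cong (((m + k) C m) *_) (*-comm (k !) (m !)) ⟩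
    ((m + k) C m) * (m ! * k !) ≡⟨ binomial-factorials-+ m k ⟩
    (m + k) !                   ≡⟨ rising-factorial m k ⟨
    rising m k * m !            ∎)

  -- Subset-of-a-subset (trinomial revision), C(M, j) C(k, i) = C(M, i) C(M − i, j) for M = j + k,
  -- in the case k = i + r: multiplied by j! i! r!, both sides become M!.
  trinomial-revision-≤ : ∀ j i r →
    ((j + (i + r)) C j) * ((i + r) C i) ≡ ((j + (i + r)) C i) * (((j + (i + r)) ∸ i) C j)
  trinomial-revision-≤ j i r = *-cancelʳ-≡ _ _ (j ! * (i ! * r !)) {{m*n≢0 (j !) (i ! * r !) {{j !≢0}} {{i !* r !≢0}}}}
    (begin
      (M C j) * ((i + r) C i) * (j ! * (i ! * r !))   ≡⟨ regroupˡ (M C j) ((i + r) C i) (j !) (i !) (r !) ⟩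
      (M C j) * (j ! * (((i + r) C i) * (i ! * r !))) ≡⟨ cong (λ z → (M C j) * (j ! * z)) (binomial-factorials-+ i r) ⟩
      (M C j) * (j ! * (i + r) !)                     ≡⟨ binomial-factorials-+ j (i + r) ⟩
      M !                                             ≡⟨ binomial-factorials i≤M ⟨
      (M C i) * (i ! * (M ∸ i) !)                     ≡⟨ cong (λ z → (M C i) * (i ! * z)) remaining ⟨
      (M C i) * (i ! * (((M ∸ i) C j) * (j ! * r !))) ≡⟨ regroupʳ (M C i) ((M ∸ i) C j) (j !) (i !) (r !) ⟩
      (M C i) * ((M ∸ i) C j) * (j ! * (i ! * r !))   ∎)
    where
    M : ℕ
    M = j + (i + r)
    i≤M : i ≤ M
    i≤M = ≤-trans (m≤m+n i r) (m≤n+m (i + r) j)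
    M∸i≡j+r : M ∸ i ≡ j + r
    M∸i≡j+r = trans (cong (_∸ i) (swap j i r)) (m+n∸m≡n i (j + r))
      where
      swap : ∀ j i r → j + (i + r) ≡ i + (j + r)
      swap = solve-∀
    remaining : ((M ∸ i) C j) * (j ! * r !) ≡ (M ∸ i) !
    remaining = subst (λ z → (z C j) * (j ! * r !) ≡ z !) (sym M∸i≡j+r) (binomial-factorials-+ j r)
    regroupˡ : ∀ a b x y z → a * b * (x * (y * z)) ≡ a * (x * (b * (y * z)))
    regroupˡ = solve-∀
    regroupʳ : ∀ a b x y z → a * (y * (b * (x * z))) ≡ a * b * (x * (y * z))
    regroupʳ = solve-∀

  revision-vanishes : ∀ j k i → k < i → ((j + k) C i) * (((j + k) ∸ i) C j) ≡ 0
  revision-vanishes zero k i k<i = cong (_* ((k ∸ i) C 0)) (k>n⇒nCk≡0 k<i)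
  revision-vanishes (suc j) k i k<i =
    trans (cong (((suc j + k) C i) *_) (k>n⇒nCk≡0 M∸i<1+j)) (*-zeroʳ ((suc j + k) C i))
    where
    M∸i<1+j : (suc j + k) ∸ i < suc j
    M∸i<1+j = m<n+o⇒m∸n<o (suc j + k) i (subst (suc j + k <_) (+-comm (suc j) i) (+-monoʳ-< (suc j) k<i))

  trinomial-revision : ∀ j k i → ((j + k) C j) * (k C i) ≡ ((j + k) C i) * (((j + k) ∸ i) C j)
  trinomial-revision j k i with i ≤? k
  ... | yes i≤k with m≤n⇒∃[o]m+o≡n i≤k
  ...   | r , refl = trinomial-revision-≤ j i r
  trinomial-revision j k i | no i≰k = begin
    ((j + k) C j) * (k C i)                   ≡⟨ cong (((j + k) C j) *_) (k>n⇒nCk≡0 (≰⇒> i≰k)) ⟩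
    ((j + k) C j) * 0                         ≡⟨ *-zeroʳ ((j + k) C j) ⟩
    0                                         ≡⟨ revision-vanishes j k i (≰⇒> i≰k) ⟨
    ((j + k) C i) * (((j + k) ∸ i) C j)       ∎

module BorosMollWeights where
  open import Data.Nat
  open import Data.Nat.Properties
  open import Data.Nat.Combinatorics using (_C_)
  open import Data.Nat.Tactic.RingSolver using (solve-∀)
  open import Data.Product using (_,_)
  open import Relation.Binary.PropositionalEquality
  open FiniteSums
  open BinomialTransform
  open FactorialIdentities

  summand : ℕ → ℕ → ℕ → ℕ
  summand m i k = 2 ^ k * ((2 * m ∸ 2 * k) C (m ∸ k)) * ((m + k) C m) * (k C i)

  -- β_j(m) = (2j − 1)!! · (m + 1)(m + 2) ⋯ (2m − j), the sequence whose binomial transform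
  -- gives the normalised coefficients d_i(m) / C(m, i).
  beta : ℕ → ℕ → ℕ
  beta m j = oddFactorial j * rising m (m ∸ j)

  summand-factorial : ∀ j k i → let m = j + k in
    m ! * summand m i k ≡ (m C i) * 2 ^ m * (beta m j * ((m ∸ i) C j))
  summand-factorial j k i = begin
    m ! * summand m i k
      ≡⟨ cong₂ (λ a b → m ! * (2 ^ k * (a C b) * Cmk * Cki)) 2m∸2k≡2j (m+n∸n≡m j k) ⟩
    m ! * (2 ^ k * C2j * Cmk * Cki)
      ≡⟨ cong (_* (2 ^ k * C2j * Cmk * Cki)) (binomial-factorials-+ j k) ⟨
    (m C j) * (j ! * k !) * (2 ^ k * C2j * Cmk * Cki)
      ≡⟨ regroup (m C j) (j !) (k !) (2 ^ k) C2j Cmk Cki ⟩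
    2 ^ k * (C2j * j !) * (Cmk * k !) * ((m C j) * Cki)
      ≡⟨ cong₂ (λ a b → 2 ^ k * a * b * ((m C j) * Cki)) (central-binomial j) (binomial-rising m k) ⟩
    2 ^ k * (2 ^ j * oddFactorial j) * rising m k * ((m C j) * Cki)
      ≡⟨ cong (2 ^ k * (2 ^ j * oddFactorial j) * rising m k *_) (trinomial-revision j k i) ⟩
    2 ^ k * (2 ^ j * oddFactorial j) * rising m k * ((m C i) * ((m ∸ i) C j))
      ≡⟨ collect (2 ^ k) (2 ^ j) (oddFactorial j) (rising m k) (m C i) ((m ∸ i) C j) ⟩
    (m C i) * (2 ^ j * 2 ^ k) * (oddFactorial j * rising m k * ((m ∸ i) C j))
      ≡⟨ cong₂ (λ a b → (m C i) * a * (oddFactorial j * rising m b * ((m ∸ i) C j)))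
               (^-distribˡ-+-* 2 j k) (m+n∸m≡n j k) ⟨
    (m C i) * 2 ^ m * (beta m j * ((m ∸ i) C j)) ∎
    where
    open ≡-Reasoning
    m C2j Cmk Cki : ℕ
    m = j + k
    C2j = (2 * j) C j
    Cmk = (m + k) C m
    Cki = k C i
    2m∸2k≡2j : 2 * m ∸ 2 * k ≡ 2 * j
    2m∸2k≡2j = trans (cong (_∸ 2 * k) (*-distribˡ-+ 2 j k)) (m+n∸n≡m (2 * j) (2 * k))
    regroup : ∀ c x y p a b e → c * (x * y) * (p * a * b * e) ≡ p * (a * x) * (b * y) * (c * e)
    regroup = solve-∀
    collect : ∀ p q o r c e → p * (q * o) * r * (c * e) ≡ c * (q * p) * (o * r * e)
    collect = solve-∀

  summand-mirror : ∀ m i j → j ≤ m →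
    m ! * summand m i (m ∸ j) ≡ (m C i) * 2 ^ m * (beta m j * ((m ∸ i) C j))
  summand-mirror m i j j≤m with m≤n⇒∃[o]m+o≡n j≤m
  ... | k , refl = subst (λ z → (j + k) ! * summand (j + k) i z
                                ≡ ((j + k) C i) * 2 ^ (j + k) * (beta (j + k) j * (((j + k) ∸ i) C j)))
                         (sym (m+n∸m≡n j k)) (summand-factorial j k i)

  scaledD-binomialTransform : ∀ m i →
    scaledD i m * m ! ≡ (m C i) * 2 ^ m * binomialTransform (beta m) (m ∸ i)
  scaledD-binomialTransform m i = begin
    scaledD i m * m !                              ≡⟨ cong (_* m !) (sum-map-upTo (summand m i) (suc m)) ⟩
    Σ (summand m i) (suc m) * m !                  ≡⟨ cong (_* m !) (Σ-reverse (summand m i) m) ⟩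
    Σ (λ j → summand m i (m ∸ j)) (suc m) * m !    ≡⟨ *-comm _ (m !) ⟩
    m ! * Σ (λ j → summand m i (m ∸ j)) (suc m)    ≡⟨ Σ-factorˡ (m !) _ (suc m) ⟨
    Σ (λ j → m ! * summand m i (m ∸ j)) (suc m)    ≡⟨ Σ-cong (suc m) (λ j j<1+m → summand-mirror m i j (≤-pred j<1+m)) ⟩
    Σ (λ j → K * (beta m j * ((m ∸ i) C j))) (suc m) ≡⟨ Σ-factorˡ K _ (suc m) ⟩
    K * Σ (λ j → beta m j * ((m ∸ i) C j)) (suc m) ≡⟨ cong (K *_) (binomialTransform-extend (beta m) (m∸n≤m m i)) ⟩
    K * binomialTransform (beta m) (m ∸ i)         ∎
    where
    open ≡-Reasoning
    K : ℕ
    K = (m C i) * 2 ^ m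

  -- Where m − j = s + 2, the ratio β_{j+1}/β_j = (2j + 1)/(m − j) is smaller than
  -- β_{j+2}/β_{j+1} = (2j + 3)/(m − j − 1), which is strict log-convexity at j.
  beta-log-convex-at : ∀ m j s → m ∸ j ≡ 2 + s → m ∸ (1 + j) ≡ 1 + s → m ∸ (2 + j) ≡ s →
    beta m (1 + j) * beta m (1 + j) < beta m j * beta m (2 + j)
  beta-log-convex-at m j s d₀ d₁ d₂ rewrite d₀ | d₁ | d₂ = subst₂ _<_ (lhs a u P x) (rhs a u P x w y) ratios
    where
    a P u w x y : ℕ
    a = oddFactorial j
    P = rising m s
    u = suc (2 * j)
    w = suc (2 * suc j)
    x = suc (m + s)
    y = suc (m + suc s)
    instance
      _ : NonZero a
      _ = oddFactorial-nonZero j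
      _ : NonZero P
      _ = rising-nonZero m s
      _ : NonZero (a * u * P * x)
      _ = m*n≢0 (a * u * P) x {{m*n≢0 (a * u) P {{m*n≢0 a u}}}}
      _ : NonZero (a * P)
      _ = m*n≢0 a P
    ratios : a * u * P * x * (a * P * (u * x)) < a * u * P * x * (a * P * (w * y))
    ratios = *-monoʳ-< (a * u * P * x) (*-monoʳ-< (a * P)
               (*-mono-< (s≤s (*-monoʳ-< 2 (n<1+n j))) (s≤s (+-monoʳ-< m (n<1+n s)))))
    lhs : ∀ a u P x → a * u * P * x * (a * P * (u * x)) ≡ a * u * (P * x) * (a * u * (P * x))
    lhs = solve-∀
    rhs : ∀ a u P x w y → a * u * P * x * (a * P * (w * y)) ≡ a * (P * x * y) * (a * u * w * P)
    rhs = solve-∀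

  ∸-offset : ∀ t j s → (t + j + s) ∸ j ≡ t + s
  ∸-offset t j s = trans (cong (_∸ j) (shuffle t j s)) (m+n∸m≡n j (t + s))
    where
    shuffle : ∀ t j s → t + j + s ≡ j + (t + s)
    shuffle = solve-∀

  beta-log-convex : ∀ m N → 2 + N ≤ m → StrictlyLogConvexUpTo (beta m) N
  beta-log-convex m N 2+N≤m j j≤N with m≤n⇒∃[o]m+o≡n (≤-trans (s≤s (s≤s j≤N)) 2+N≤m)
  ... | s , refl = beta-log-convex-at (2 + j + s) j s (∸-offset 2 j s) (∸-offset 1 j s) (∸-offset 0 j s)

module Fractions where
  open import Data.Nat as ℕ using (ℕ; suc; NonZero)
  import Data.Nat.Properties as ℕ
  open import Data.Integer using (+_; +<+)
  import Data.Integer as ℤ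
  import Data.Integer.Properties as ℤ
  open import Data.Rational as ℚ using (ℚ; toℚᵘ)
  import Data.Rational.Properties as ℚ
  open import Data.Rational.Unnormalised as ℚᵘ using (*≡*; *<*)
  import Data.Rational.Unnormalised.Properties as ℚᵘ
  open import Relation.Binary.PropositionalEquality

  toℚᵘ-/ : ∀ a d → toℚᵘ ((+ a) ℚ./ suc d) ℚᵘ.≃ (+ a) ℚᵘ./ suc d
  toℚᵘ-/ a d = ℚ./-injective-≃ (toℚᵘ ((+ a) ℚ./ suc d)) ((+ a) ℚᵘ./ suc d) (round-trip ((+ a) ℚ./ suc d))
    where
    round-trip : ∀ p → ℚᵘ.↥ (toℚᵘ p) ℚ./ ℚᵘ.↧ₙ (toℚᵘ p) ≡ p
    round-trip p@record{} = ℚ.↥p/↧p≡p p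

  /ᵘ-≃ : ∀ a b d e → a ℕ.* suc e ≡ b ℕ.* suc d → (+ a) ℚᵘ./ suc d ℚᵘ.≃ (+ b) ℚᵘ./ suc e
  /ᵘ-≃ a b d e eq = *≡* (trans (sym (ℤ.pos-* a (suc e))) (trans (cong +_ eq) (ℤ.pos-* b (suc d))))

  /ᵘ-< : ∀ a b d e → a ℕ.* suc e ℕ.< b ℕ.* suc d → (+ a) ℚᵘ./ suc d ℚᵘ.< (+ b) ℚᵘ./ suc e
  /ᵘ-< a b d e lt = *<* (subst₂ ℤ._<_ (ℤ.pos-* a (suc e)) (ℤ.pos-* b (suc d)) (+<+ lt))

  /ᵘ-* : ∀ a b d e → ((+ a) ℚᵘ./ suc d) ℚᵘ.* ((+ b) ℚᵘ./ suc e) ℚᵘ.≃ (+ (a ℕ.* b)) ℚᵘ./ (suc d ℕ.* suc e)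
  /ᵘ-* a b d e = *≡* (cong (ℤ._* (+ (suc d ℕ.* suc e))) (sym (ℤ.pos-* a b)))

  ÷ℕ-rescale : ∀ S A C T K .{{_ : NonZero A}} .{{_ : NonZero K}} → 0 ℕ.< C →
    S ℕ.* K ≡ T ℕ.* (A ℕ.* C) → ((+ S) ℚ./ A) ÷ℕ C ≡ (+ T) ℚ./ K
  ÷ℕ-rescale S (suc a) (suc c) T (suc k) _ SK≡TAC = ℚ.toℚᵘ-injective (begin-equality
    toℚᵘ (S/A ℚ.* 1/C)                                ≃⟨ ℚ.toℚᵘ-homo-* S/A 1/C ⟩
    toℚᵘ S/A ℚᵘ.* toℚᵘ 1/C                            ≃⟨ ℚᵘ.*-cong (toℚᵘ-/ S a) (toℚᵘ-/ 1 c) ⟩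
    ((+ S) ℚᵘ./ suc a) ℚᵘ.* ((+ 1) ℚᵘ./ suc c)        ≃⟨ /ᵘ-* S 1 a c ⟩
    (+ (S ℕ.* 1)) ℚᵘ./ (suc a ℕ.* suc c)              ≃⟨ /ᵘ-≃ (S ℕ.* 1) T (c ℕ.+ a ℕ.* suc c) k
                                                          (trans (cong (ℕ._* suc k) (ℕ.*-identityʳ S)) SK≡TAC) ⟩
    (+ T) ℚᵘ./ suc k                                  ≃⟨ toℚᵘ-/ T k ⟨
    toℚᵘ ((+ T) ℚ./ suc k)                            ∎)
    where
    open ℚᵘ.≤-Reasoning
    S/A 1/C : ℚ
    S/A = (+ S) ℚ./ suc a
    1/C = (+ 1) ℚ./ suc c

  common-denominator-< : ∀ x y z K .{{_ : NonZero K}} → x ℕ.* x ℕ.< y ℕ.* z →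
    ((+ x) ℚ./ K) ℚ.* ((+ x) ℚ./ K) ℚ.< ((+ y) ℚ./ K) ℚ.* ((+ z) ℚ./ K)
  common-denominator-< x y z (suc k) x²<yz = ℚ.toℚᵘ-cancel-< (begin-strict
    toℚᵘ (x/K ℚ.* x/K)                          ≃⟨ ℚ.toℚᵘ-homo-* x/K x/K ⟩
    toℚᵘ x/K ℚᵘ.* toℚᵘ x/K                      ≃⟨ ℚᵘ.*-cong (toℚᵘ-/ x k) (toℚᵘ-/ x k) ⟩
    ((+ x) ℚᵘ./ suc k) ℚᵘ.* ((+ x) ℚᵘ./ suc k)  ≃⟨ /ᵘ-* x x k k ⟩
    (+ (x ℕ.* x)) ℚᵘ./ (suc k ℕ.* suc k)        <⟨ /ᵘ-< (x ℕ.* x) (y ℕ.* z) K²-1 K²-1 (ℕ.*-monoˡ-< (suc k ℕ.* suc k) x²<yz) ⟩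
    (+ (y ℕ.* z)) ℚᵘ./ (suc k ℕ.* suc k)        ≃⟨ /ᵘ-* y z k k ⟨
    ((+ y) ℚᵘ./ suc k) ℚᵘ.* ((+ z) ℚᵘ./ suc k)  ≃⟨ ℚᵘ.*-cong (toℚᵘ-/ y k) (toℚᵘ-/ z k) ⟨
    toℚᵘ y/K ℚᵘ.* toℚᵘ z/K                      ≃⟨ ℚ.toℚᵘ-homo-* y/K z/K ⟨
    toℚᵘ (y/K ℚ.* z/K)                          ∎)
    where
    open ℚᵘ.≤-Reasoning
    K²-1 : ℕ
    K²-1 = k ℕ.+ k ℕ.* suc k
    x/K y/K z/K : ℚ
    x/K = (+ x) ℚ./ suc k
    y/K = (+ y) ℚ./ suc k
    z/K = (+ z) ℚ./ suc k

module NormalisedCoefficients where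
  open import Data.Nat
  open import Data.Nat.Properties
  open import Data.Nat.Combinatorics using (_C_)
  open import Data.Nat.Tactic.RingSolver using (solve-∀)
  open import Data.Integer using (+_)
  open import Data.Rational as ℚ using (ℚ)
  open import Relation.Binary.PropositionalEquality
  open BinomialTransform
  open FactorialIdentities
  open BorosMollWeights
  open Fractions

  denominator : ℕ → ℕ
  denominator m = 2 ^ m * m !

  denominator-nonZero : ∀ m → NonZero (denominator m)
  denominator-nonZero m = m*n≢0 (2 ^ m) (m !) {{m^n≢0 2 m}} {{m !≢0}}

  normalisedFraction : ℕ → ℕ → ℚ
  normalisedFraction m n = ((+ binomialTransform (beta m) n) ℚ./ denominator m) {{denominator-nonZero m}}

  normalised-coefficient : ∀ m i → i ≤ m → d i m ÷ℕ (m C i) ≡ normalisedFraction m (m ∸ i)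
  normalised-coefficient m i i≤m =
    ÷ℕ-rescale (scaledD i m) (2 ^ (2 * m)) (m C i) T (denominator m) {{m^n≢0 2 (2 * m)}} {{denominator-nonZero m}}
               (binomial-positive i≤m) cross-multiplied
    where
    open ≡-Reasoning
    T : ℕ
    T = binomialTransform (beta m) (m ∸ i)
    cross-multiplied : scaledD i m * (2 ^ m * m !) ≡ T * (2 ^ (2 * m) * (m C i))
    cross-multiplied = begin
      scaledD i m * (2 ^ m * m !)    ≡⟨ pull-out (scaledD i m) (2 ^ m) (m !) ⟩
      2 ^ m * (scaledD i m * m !)    ≡⟨ cong (2 ^ m *_) (scaledD-binomialTransform m i) ⟩
      2 ^ m * ((m C i) * 2 ^ m * T)  ≡⟨ regroup (2 ^ m) (m C i) T ⟩
      T * (2 ^ m * 2 ^ m * (m C i))  ≡⟨ cong (λ z → T * (z * (m C i))) (^-distribˡ-+-* 2 m m) ⟨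
      T * (2 ^ (m + m) * (m C i))    ≡⟨ cong (λ z → T * (2 ^ z * (m C i))) (double m) ⟨
      T * (2 ^ (2 * m) * (m C i))    ∎
      where
      pull-out : ∀ s p f → s * (p * f) ≡ p * (s * f)
      pull-out = solve-∀
      regroup : ∀ p c t → p * (c * p * t) ≡ t * (p * p * c)
      regroup = solve-∀
      double : ∀ m → 2 * m ≡ m + m
      double = solve-∀

  numerator-log-convex : ∀ m i → 1 ≤ i → i ≤ m →
    let T = binomialTransform (beta (suc m)) in
    T (suc m ∸ i) * T (suc m ∸ i) < T (suc m ∸ (i ∸ 1)) * T (suc m ∸ suc i)
  numerator-log-convex m i 1≤i i≤m = begin-strict
    T (suc m ∸ i) * T (suc m ∸ i)             ≡⟨ cong (λ k → T k * T k) (+-∸-assoc 1 i≤m) ⟩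
    T (1 + N) * T (1 + N)                     <⟨ binomialTransform-log-convex (beta (suc m)) N
                                                   (beta-log-convex (suc m) N 2+N≤1+m) ⟩
    T N * T (2 + N)                           ≡⟨ *-comm (T N) (T (2 + N)) ⟩
    T (2 + N) * T N                           ≡⟨ cong (λ k → T k * T N) two-more ⟨
    T (suc m ∸ (i ∸ 1)) * T (suc m ∸ suc i)   ∎
    where
    open ≤-Reasoning
    T : ℕ → ℕ
    T = binomialTransform (beta (suc m))
    N : ℕ
    N = m ∸ i
    two-more : suc m ∸ (i ∸ 1) ≡ 2 + N
    two-more = trans (cong (suc (suc m) ∸_) (m+[n∸m]≡n 1≤i)) (+-∸-assoc 2 i≤m)
    2+N≤1+m : 2 + N ≤ suc m
    2+N≤1+m = subst (_≤ suc m) two-more (m∸n≤m (suc m) (i ∸ 1))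

  normalisedFraction-log-convex : ∀ m i → 1 ≤ i → i ≤ m →
    normalisedFraction (suc m) (suc m ∸ i) ℚ.* normalisedFraction (suc m) (suc m ∸ i)
      ℚ.< normalisedFraction (suc m) (suc m ∸ (i ∸ 1)) ℚ.* normalisedFraction (suc m) (suc m ∸ suc i)
  normalisedFraction-log-convex m i 1≤i i≤m =
    common-denominator-< (T (suc m ∸ i)) (T (suc m ∸ (i ∸ 1))) (T (suc m ∸ suc i))
      (denominator (suc m)) {{denominator-nonZero (suc m)}} (numerator-log-convex m i 1≤i i≤m)
    where
    T : ℕ → ℕ
    T = binomialTransform (beta (suc m))

open import Data.Nat using (ℕ; _≤_; _∸_; suc)
open import Data.Nat.Combinatorics using (_C_)
open import Data.Rational using (_<_; _*_)
open import Data.Nat using (s≤s)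
open import Data.Nat.Properties using (≤-trans; m∸n≤m; m≤n⇒m≤1+n)
open import Relation.Binary.PropositionalEquality using (_≡_; sym; cong₂; subst₂)
open NormalisedCoefficients

theorem1p1 : (m i : ℕ) → 2 ≤ m → 1 ≤ i → i ≤ m ∸ 1 →
    (d i m ÷ℕ (m C i)) * (d i m ÷ℕ (m C i))
    < (d (i ∸ 1) m ÷ℕ (m C (i ∸ 1))) * (d (suc i) m ÷ℕ (m C (suc i)))
theorem1p1 (suc m) i _ 1≤i i≤m = subst₂ _<_
  (sym (cong₂ _*_ (value i i≤1+m) (value i i≤1+m)))
  (sym (cong₂ _*_ (value (i ∸ 1) (≤-trans (m∸n≤m i 1) i≤1+m)) (value (suc i) (s≤s i≤m))))
  (normalisedFraction-log-convex m i 1≤i i≤m)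
  where
  i≤1+m : i ≤ suc m
  i≤1+m = m≤n⇒m≤1+n i≤m
  value : ∀ j → j ≤ suc m → d j (suc m) ÷ℕ (suc m C j) ≡ normalisedFraction (suc m) (suc m ∸ j)
  value = normalised-coefficient (suc m)
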